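{- For every (monadic, finitary) $\pi$-term $P$, the typed solos term $[\![P]\!]$ is an acyclic solos term, with respect to the environment assigning type $W$ to every free name of $P$.
   Context: $\pi$-terms: $P ::= 0 \mid u(x).P \mid \overline{u}\langle x\rangle.P \mid (P\mid P) \mid (\nu x)P$, where $u(x).P$ and $(\nu x)P$ bind $x$ in $P$. Triadic solos terms: $P ::= 0 \mid u(x_1x_2x_3) \mid \overline{u}\langle x_1x_2x_3\rangle \mid (P\mid P) \mid (\nu x)P$, where $(\nu x)P$ binds $x$. $u(x_1x_2x_3)$ is an input solo, $\overline u\langle x_1x_2x_3\rangle$ an output solo; $u$ is its subject and the three positions $x_1,x_2,x_3$ are its object occurrences. A solo of a term means an occurrence of an input or output solo in it. Types: two types $V$ and $W$; typed terms are solos terms whose restrictions carry a type, $(\nu x^U)P$ with $U\in\{V,W\}$. An environment $\Gamma$ is a finite map from names to types; $\Gamma,x:U$ is its extension by a fresh name $x$. Typing judgments $\Gamma\vdash P$ are derived by: $\Gamma\vdash 0$; from $\Gamma\vdash P$ and $\Gamma\vdash Q$ infer $\Gamma\vdash P\mid Q$; from $\Gamma,x:U\vdash P$ infer $\Gamma\vdash(\nu x^U)P$; and for a solo (input or output) with subject $u$ and objects $a,b,c$, $\Gamma\vdash$ the solo whenever $\Gamma$ is defined on $u,a,b,c$ and $(\Gamma(u),\Gamma(a),\Gamma(b),\Gamma(c))$ is $(V,W,W,V)$ or $(W,W,V,V)$. Communication protocols: given $\Gamma\vdash P$, every object occurrence in $P$ receives a protocol $\mathsf S$ (send) or $\mathsf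 R$ (receive), determined by the polarity of its solo and the type of the subject (under $\Gamma$ extended by enclosing restriction annotations): input solo with subject of type $V$: objects get $\mathsf R,\mathsf S,\mathsf S$ in order; input with subject of type $W$: $\mathsf R,\mathsf S,\mathsf R$; output with subject of type $V$: $\mathsf S,\mathsf R,\mathsf R$; output with subject of type $W$: $\mathsf S,\mathsf R,\mathsf S$. An $\mathsf X$-occurrence of $x$ is an object occurrence of $x$ with protocol $\mathsf X$. Relations on solos $s,t$ of $P$ (bound names of $P$ being chosen, by $\alpha$-conversion, pairwise distinct and distinct from free names): $x\in s$ iff $x$ has an object occurrence in $s$; $s\triangleleft x$ iff $x$ has an $\mathsf R$-occurrence in $s$; $s\triangleleft t$ iff $s\triangleleft \mathrm{subj}(t)$; $s\perp t$ iff $s,t$ have the same subject and one is input, the other output; $s$ is a root iff there is no solo $t$ with $t\triangleleft s$. $\triangleleft^\star$ is the reflexive transitive closure and $\triangleleft^+$ the transitive closure of $\triangleleft$. An acyclic solos term (with respect to $\Gamma$) is a typed term $P$ with $\Gamma\vdash P$ such that, for the induced protocols: (AC1) each name has at most one $\mathsf R$-occurrence; (AC2) $s\perp t$ implies that $s$ and $t$ are roots; (AC3) $s\triangleleft x$ and $x\in t$ imply $s\triangleleft^\star t$; (AC4) if $x$ has an $\mathsf S$-occurrence in $s$ and $s\triangleleft x$ then $s$ is an input solo; (AC5) no free name of $P$ has an $\mathsf R$-occurrence. Translation (with fresh names $w,y,z,v'$ each time): $C(v) := (\nu z^W)\, v(zzv)$; $[\![0]\!]_v:=0$; $[\![u(x).P]\!]_v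 := (\nu w^W)(\nu y^V)(\overline v\langle uwy\rangle \mid C(y) \mid (\nu x^W)(\nu v'^V)(w(xvv')\mid [\![P]\!]_{v'}))$; $[\![\overline u\langle x\rangle.P]\!]_v := (\nu w^W)(\nu y^V)(\overline v\langle uwy\rangle \mid C(y) \mid (\nu v'^V)(\overline w\langle xv'v\rangle\mid [\![P]\!]_{v'}))$; $[\![P\mid Q]\!]_v := [\![P]\!]_v\mid[\![Q]\!]_v$; $[\![(\nu x)P]\!]_v := (\nu x^W)[\![P]\!]_v$; $[\![P]\!] := (\nu v^V)([\![P]\!]_v\mid C(v))$. -}

module Defs where

open import Data.Nat using (ℕ; zero; suc; _⊔_; _≡ᵇ_)
open import Data.Bool using (Bool; true; false; if_then_else_; _∨_)
open import Data.Maybe using (Maybe; just; nothing)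
open import Data.Product using (Σ; ∃; _×_; _,_; proj₁)
open import Data.Sum using (_⊎_)
open import Data.List using (List; []; _∷_; _++_; length; lookup)
open import Data.Fin using (Fin; zero; suc)
open import Relation.Binary.PropositionalEquality using (_≡_; _≢_)
open import Relation.Binary.Construct.Closure.ReflexiveTransitive using (Star)
open import Relation.Nullary using (¬_)

Name : Set
Name = ℕ

-- Monadic finitary π-terms (named syntax; inp u x P binds x in P,
-- nu x P binds x in P)

data Pi : Set where
  nil : Pi
  inp : Name → Name → Pi → Pi          -- u(x).P
  out : Name → Name → Pi → Pi          -- ū⟨x⟩.P
  par : Pi → Pi → Pi
  nu  : Name → Pi → Pi

isFree : Pi → Name → Bool
isFree nil         n = false
isFree (inp u x P) n = (n ≡ᵇ u) ∨ (if n ≡ᵇ x then false else isFree P n)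
isFree (out u x P) n = (n ≡ᵇ u) ∨ (n ≡ᵇ x) ∨ isFree P n
isFree (par P Q)   n = isFree P n ∨ isFree Q n
isFree (nu x P)    n = if n ≡ᵇ x then false else isFree P n

maxName : Pi → ℕ
maxName nil         = 0
maxName (inp u x P) = u ⊔ x ⊔ maxName P
maxName (out u x P) = u ⊔ x ⊔ maxName P
maxName (par P Q)   = maxName P ⊔ maxName Q
maxName (nu x P)    = x ⊔ maxName P

data Ty : Set where
  V W : Ty

data Pol : Set where
  In Out : Pol

data Sol : Set where
  nil  : Sol
  solo : Pol → Name → Name → Name → Name → Sol
  par  : Sol → Sol → Sol
  nu   : Name → Ty → Sol → Sol

Env : Set
Env = Name → Maybe Ty

-- Γ , x : U  (with α-conversion, extension by a fresh name is update)
_,,_∶_ : Env → Name → Ty → Env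
(Γ ,, x ∶ U) n = if n ≡ᵇ x then just U else Γ n

data SoloTyped (Γ : Env) (u a b c : Name) : Set where
  shapeVWWV : Γ u ≡ just V → Γ a ≡ just W → Γ b ≡ just W → Γ c ≡ just V →
              SoloTyped Γ u a b c
  shapeWWVV : Γ u ≡ just W → Γ a ≡ just W → Γ b ≡ just V → Γ c ≡ just V →
              SoloTyped Γ u a b c

data _⊢_ : Env → Sol → Set where
  t-nil  : ∀ {Γ} → Γ ⊢ nil
  t-par  : ∀ {Γ P Q} → Γ ⊢ P → Γ ⊢ Q → Γ ⊢ par P Q
  t-nu   : ∀ {Γ x U P} → (Γ ,, x ∶ U) ⊢ P → Γ ⊢ nu x U P
  t-solo : ∀ {Γ p u a b c} → SoloTyped Γ u a b c → Γ ⊢ solo p u a b c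

data Proto : Set where
  S R : Proto

proto : Pol → Ty → Fin 3 → Proto
proto In  V zero             = R
proto In  V (suc zero)       = S
proto In  V (suc (suc zero)) = S
proto In  W zero             = R
proto In  W (suc zero)       = S
proto In  W (suc (suc zero)) = R
proto Out V zero             = S
proto Out V (suc zero)       = R
proto Out V (suc (suc zero)) = R
proto Out W zero             = S
proto Out W (suc zero)       = R
proto Out W (suc (suc zero)) = S

-- Choosing bound names pairwise distinct and distinct from free names:
-- every name occurrence is resolved to a global name, either a free
-- name, or the (unique) tree position of its binding restriction.

data Dir : Set where
  L Rt N : Dir

data GN : Set where
  fr : Name → GN
  bd : List Dir → GN

record RSolo : Set where
  field
    pol  : Pol
    subj : GN
    sty  : Maybe Ty          -- type of the subject in the current environment
    obj  : Fin 3 → GN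

open RSolo public

protoAt : RSolo → Fin 3 → Maybe Proto
protoAt s i with sty s
... | just U  = just (proto (pol s) U i)
... | nothing = nothing

triple : GN → GN → GN → Fin 3 → GN
triple a b c zero             = a
triple a b c (suc zero)       = b
triple a b c (suc (suc zero)) = c

flatten : (Name → GN) → Env → List Dir → Sol → List RSolo
flatten ρ τ p nil = []
flatten ρ τ p (solo q u a b c) =
  record { pol = q ; subj = ρ u ; sty = τ u ; obj = triple (ρ a) (ρ b) (ρ c) } ∷ []
flatten ρ τ p (par P Q) = flatten ρ τ (L ∷ p) P ++ flatten ρ τ (Rt ∷ p) Q
flatten ρ τ p (nu x U P) =
  flatten (λ n → if n ≡ᵇ x then bd p else ρ n) (τ ,, x ∶ U) (N ∷ p) P

solosOf : Env → Sol → List RSolo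
solosOf Γ P = flatten fr Γ [] P

-- Relations on the solos of a term (solos = occurrences = indices)

module Relations (Ss : List RSolo) where

  Solo : Set
  Solo = Fin (length Ss)

  sol : Solo → RSolo
  sol = lookup Ss

  _∈ₛ_ : GN → Solo → Set
  x ∈ₛ s = ∃ λ i → obj (sol s) i ≡ x

  Occ : Proto → Solo → Fin 3 → GN → Set
  Occ X s i x = obj (sol s) i ≡ x × protoAt (sol s) i ≡ just X

  _◁_ : Solo → GN → Set
  s ◁ x = ∃ λ i → Occ R s i x

  _◁ₛ_ : Solo → Solo → Set
  s ◁ₛ t = s ◁ subj (sol t)

  _◁⋆_ : Solo → Solo → Set
  _◁⋆_ = Star _◁ₛ_

  _⊥ₛ_ : Solo → Solo → Set
  s ⊥ₛ t = subj (sol s) ≡ subj (sol t) × pol (sol s) ≢ pol (sol t)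

  IsRoot : Solo → Set
  IsRoot s = ¬ (∃ λ t → t ◁ₛ s)

  AC1 : Set
  AC1 = ∀ x s i t j → Occ R s i x → Occ R t j x → (s ≡ t × i ≡ j)

  AC2 : Set
  AC2 = ∀ s t → s ⊥ₛ t → IsRoot s × IsRoot t

  AC3 : Set
  AC3 = ∀ s t x → s ◁ x → x ∈ₛ t → s ◁⋆ t

  AC4 : Set
  AC4 = ∀ s i x → Occ S s i x → s ◁ x → pol (sol s) ≡ In

  AC5 : Set
  AC5 = ∀ s (x : Name) → ¬ (s ◁ fr x)

record Acyclic (Γ : Env) (P : Sol) : Set where
  open Relations (solosOf Γ P)
  field
    typed : Γ ⊢ P
    ac1   : AC1
    ac2   : AC2
    ac3   : AC3
    ac4   : AC4
    ac5   : AC5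

-- Translation. Fresh names are drawn from a counter k that starts
-- above every name of the source term.

C : Name → Name → Sol
C z v = nu z W (solo In v z z v)

tr : Pi → Name → ℕ → Sol × ℕ
tr nil v k = nil , k
tr (inp u x P) v k with tr P (suc (suc (suc k))) (suc (suc (suc (suc k))))
... | Q , k' =
  let w = k ; y = suc k ; z = suc (suc k) ; v' = suc (suc (suc k)) in
  nu w W (nu y V (par (solo Out v u w y)
                  (par (C z y)
                       (nu x W (nu v' V (par (solo In w x v v') Q)))))) , k'
tr (out u x P) v k with tr P (suc (suc (suc k))) (suc (suc (suc (suc k))))
... | Q , k' =
  let w = k ; y = suc k ; z = suc (suc k) ; v' = suc (suc (suc k)) in
  nu w W (nu y V (par (solo Out v u w y)
                  (par (C z y)
                       (nu v' V (par (solo Out w x v' v) Q))))) , k'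
tr (par P Q) v k with tr P v k
... | P' , k₁ with tr Q v k₁
... | Q' , k₂ = par P' Q' , k₂
tr (nu x P) v k with tr P v k
... | P' , k' = nu x W P' , k'

⟦_⟧ : Pi → Sol
⟦ P ⟧ = let v = suc (maxName P) in
        nu v V (par (proj₁ (tr P v (suc (suc v)))) (C (suc v) v))

freeW : Pi → Env
freeW P n = if isFree P n then just W else nothing

-- Bound names are resolved to the tree positions of their binders (as in
-- Defs.flatten), so the solos of ⟦P⟧_v form an explicit list `solosTr`
-- that no longer depends on the fresh-name counter of the translation
-- (`flatten-tr`); separately, the translation is well typed (`tr-typed`).
-- The acyclicity conditions are proved for solosTr by induction on P,
-- through the invariant `Inv`: all names received by the translation at
-- position p are bound below p, no name is received twice, no input and
-- output share a subject, receivers reach the solos mentioning what they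
-- receive, and receiving the channel reaches every solo.  Scoping (the
-- suffix order on positions) does the work: sibling subterms, and the
-- handshake w, y, z of a prefix versus its body, bind disjoint names.

module Submission where

open import Defs
open import Data.Nat using (ℕ; suc; _+_; _⊔_; _≡ᵇ_; _<_; _≤_; _<?_)
open import Data.Nat.Properties
  using (≡ᵇ⇒≡; ≡⇒≡ᵇ; <⇒≢; >⇒≢; <⇒≱; ≤-refl; ≤-trans; ≤-<-trans; <-trans; <-≤-trans; m≤n⇒m≤o+n;
         n<1+n; ≤-reflexive; m≤m⊔n; m≤n⊔m; m+n≤o⇒n≤o; +-monoˡ-<)
open import Data.Bool using (true; false; if_then_else_; T)
open import Data.Bool.Properties using (T-∨)
open import Data.Maybe using (Maybe; just)
open import Data.Product using (∃; _×_; _,_; proj₁; proj₂; swap)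
open import Data.Sum using (_⊎_; inj₁; inj₂; map₂)
open import Data.Fin using (Fin; zero; suc)
open import Data.Empty using (⊥; ⊥-elim)
open import Data.List using (List; []; _∷_; _++_; length)
open import Data.List.Properties using (length-++)
open import Data.List.Relation.Unary.All as All using (All; []; _∷_)
import Data.List.Relation.Unary.All.Properties as All
open import Data.List.Relation.Unary.AllPairs as AllPairs using (AllPairs; []; _∷_)
import Data.List.Relation.Unary.AllPairs.Properties as AllPairs
open import Data.List.Relation.Unary.Any using (here; there)
open import Data.List.Relation.Unary.Any.Properties using (lookup-index)
open import Data.List.Membership.Propositional using (_∈_)
open import Data.List.Membership.Propositional.Properties using (∈-++⁺ˡ; ∈-++⁺ʳ; ∈-++⁻; ∈-lookup)
open import Data.List.Relation.Binary.Pointwise.Base using (_∷_)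
open import Data.List.Relation.Binary.Suffix.Heterogeneous using (Suffix)
import Data.List.Relation.Binary.Suffix.Heterogeneous.Properties as Suffix
open import Data.List.Relation.Binary.Suffix.Propositional.Properties using (∣ʳ-as-Suffix; Suffix-as-∣ʳ)
open import Function.Bundles using (Equivalence)
open import Relation.Binary.PropositionalEquality using (_≡_; _≢_; refl; sym; trans; subst; cong; cong₂)
open import Relation.Binary.Construct.Closure.ReflexiveTransitive using (ε; _◅_)
open import Relation.Nullary using (¬_)
open import Relation.Nullary.Decidable using (True; toWitness)

open Equivalence using (to; from)

-- Updating a name-indexed map at one name.  Both the binders of
-- `flatten` and the extension Γ ,, x ∶ U are (definitionally) updates.
upd : {A : Set} → (Name → A) → Name → A → Name → A
upd f x a n = if n ≡ᵇ x then a else f n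

upd-≡ : ∀ {A} (f : Name → A) x a → upd f x a x ≡ a
upd-≡ f x a with x ≡ᵇ x | ≡⇒≡ᵇ x x refl
... | true | _ = refl

upd-≢ : ∀ {A} (f : Name → A) {x n} a → n ≢ x → upd f x a n ≡ f n
upd-≢ f {x} {n} a n≢x with n ≡ᵇ x | ≡ᵇ⇒≡ n x
... | true  | n≡x = ⊥-elim (n≢x (n≡x _))
... | false | _   = refl

upd-< : ∀ {A} (f : Name → A) {x n} a → n < x → upd f x a n ≡ f n
upd-< f a n<x = upd-≢ f a (<⇒≢ n<x)

upd-> : ∀ {A} (f : Name → A) {x n} a → x < n → upd f x a n ≡ f n
upd-> f a x<n = upd-≢ f a (>⇒≢ x<n)

below+ : ∀ i {n k} → n < k → n < i + k
below+ i = m≤n⇒m≤o+n i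

Agree : {A : Set} → ℕ → (Name → A) → (Name → A) → Set
Agree b f g = ∀ n → n ≤ b → f n ≡ g n

agree-mono : ∀ {A} {b b′} {f g : Name → A} → b′ ≤ b → Agree b f g → Agree b′ f g
agree-mono b′≤b ag n n≤b′ = ag n (≤-trans n≤b′ b′≤b)

agree-fresh : ∀ {A} {b k} {f g : Name → A} a → b < k → Agree b f g → Agree b (upd f k a) g
agree-fresh {f = f} a b<k ag n n≤b = trans (upd-< f a (≤-<-trans n≤b b<k)) (ag n n≤b)

agree-upd : ∀ {A} {b} {f g : Name → A} x a → Agree b f g → Agree b (upd f x a) (upd g x a)
agree-upd x a ag n n≤b with n ≡ᵇ x
... | true  = refl
... | false = ag n n≤b

-- Environments inside the translation of a prefix at counter k, built
-- from the outer environment f: the handshake ν w ν y (w = k, y = 1 + k),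
-- and the bodies of an input (ν x ν v′) and of an output (ν v′), where
-- v′ = 3 + k.
hsEnv : {A : Set} → (Name → A) → ℕ → A → A → Name → A
hsEnv f k a b = upd (upd f k a) (suc k) b

inEnv : {A : Set} → (Name → A) → ℕ → A → A → Name → A → A → Name → A
inEnv f k a b x d e = upd (upd (hsEnv f k a b) x d) (3 + k) e

outEnv : {A : Set} → (Name → A) → ℕ → A → A → A → Name → A
outEnv f k a b e = upd (hsEnv f k a b) (3 + k) e

module _ {A : Set} (f : Name → A) (k : ℕ) (a b : A) where

  hs-old : ∀ {n} → n < k → hsEnv f k a b n ≡ f n
  hs-old n<k = trans (upd-< (upd f k a) b (below+ 1 n<k)) (upd-< f a n<k)

  hs-w : hsEnv f k a b k ≡ a
  hs-w = trans (upd-< (upd f k a) b (n<1+n k)) (upd-≡ f k a)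

  hs-y : hsEnv f k a b (suc k) ≡ b
  hs-y = upd-≡ (upd f k a) (suc k) b

  module _ {x : Name} (d e : A) (x<k : x < k) where

    in-old : ∀ {n} → n < k → x < n → inEnv f k a b x d e n ≡ f n
    in-old n<k x<n = trans (upd-< (upd (hsEnv f k a b) x d) e (below+ 3 n<k))
                           (trans (upd-> (hsEnv f k a b) d x<n) (hs-old n<k))

    in-w : inEnv f k a b x d e k ≡ a
    in-w = trans (upd-< (upd (hsEnv f k a b) x d) e (below+ 2 (n<1+n k)))
                 (trans (upd-> (hsEnv f k a b) d x<k) hs-w)

    in-x : inEnv f k a b x d e x ≡ d
    in-x = trans (upd-< (upd (hsEnv f k a b) x d) e (below+ 3 x<k)) (upd-≡ (hsEnv f k a b) x d)

    in-v′ : inEnv f k a b x d e (3 + k) ≡ e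
    in-v′ = upd-≡ (upd (hsEnv f k a b) x d) (3 + k) e

  module _ (e : A) where

    out-old : ∀ {n} → n < k → outEnv f k a b e n ≡ f n
    out-old n<k = trans (upd-< (hsEnv f k a b) e (below+ 3 n<k)) (hs-old n<k)

    out-w : outEnv f k a b e k ≡ a
    out-w = trans (upd-< (hsEnv f k a b) e (below+ 2 (n<1+n k))) hs-w

    out-v′ : outEnv f k a b e (3 + k) ≡ e
    out-v′ = upd-≡ (hsEnv f k a b) (3 + k) e

in-agree : ∀ {A} {b k x} {f g : Name → A} {a c d e} → b < k → Agree b f g →
           Agree b (inEnv f k a c x d e) (upd g x d)
in-agree b<k ag =
  agree-fresh _ (below+ 3 b<k) (agree-upd _ _ (agree-fresh _ (below+ 1 b<k) (agree-fresh _ b<k ag)))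

out-agree : ∀ {A} {b k} {f g : Name → A} {a c e} → b < k → Agree b f g → Agree b (outEnv f k a c e) g
out-agree b<k ag = agree-fresh _ (below+ 3 b<k) (agree-fresh _ (below+ 1 b<k) (agree-fresh _ b<k ag))

-- The solos of the translation, with bound names resolved

-- Positions, relative to the position p of a translated prefix, of the
-- restrictions it introduces (ν w sits at p itself): ν y, ν z of C(y),
-- the body binder (ν x of an input, ν v′ of an output), ν v′ of an
-- input, and the continuations of an input and an output.
yPos zPos bodyPos v′Pos inContPos outContPos : List Dir
yPos       = N ∷ []
zPos       = L ∷ Rt ∷ N ∷ N ∷ []
bodyPos    = Rt ∷ Rt ∷ N ∷ N ∷ []
v′Pos      = N ∷ bodyPos
inContPos  = Rt ∷ N ∷ N ∷ bodyPos
outContPos = Rt ∷ N ∷ bodyPos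

mkSolo : Pol → GN → Ty → GN → GN → GN → RSolo
mkSolo q s U a b c = record { pol = q ; subj = s ; sty = just U ; obj = triple a b c }

-- v̄⟨u w y⟩ and C(y) = (ν z) y(z z y): the handshake of every prefix
sendSolo : GN → GN → List Dir → RSolo
sendSolo c a p = mkSolo Out c V a (bd p) (bd (yPos ++ p))

ySolo : List Dir → RSolo
ySolo p = mkSolo In (bd (yPos ++ p)) V (bd (zPos ++ p)) (bd (zPos ++ p)) (bd (yPos ++ p))

-- w(x v v′) for an input and w̄⟨x v′ v⟩ for an output
inSolo : GN → List Dir → RSolo
inSolo c p = mkSolo In (bd p) W (bd (bodyPos ++ p)) c (bd (v′Pos ++ p))

outSolo : GN → GN → List Dir → RSolo
outSolo c a p = mkSolo Out (bd p) W a (bd (bodyPos ++ p)) c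

-- solosTr σ c p P: the solos of ⟦P⟧_v placed at position p, where σ
-- resolves the names of P and c is the resolution of v.
solosTr : (Name → GN) → GN → List Dir → Pi → List RSolo
solosTr σ c p nil = []
solosTr σ c p (inp u x P) =
  sendSolo c (σ u) p ∷ ySolo p ∷ inSolo c p ∷
  solosTr (upd σ x (bd (bodyPos ++ p))) (bd (v′Pos ++ p)) (inContPos ++ p) P
solosTr σ c p (out u x P) =
  sendSolo c (σ u) p ∷ ySolo p ∷ outSolo c (σ x) p ∷
  solosTr σ (bd (bodyPos ++ p)) (outContPos ++ p) P
solosTr σ c p (par P Q) = solosTr σ c (L ∷ p) P ++ solosTr σ c (Rt ∷ p) Q
solosTr σ c p (nu x P)  = solosTr (upd σ x (bd p)) c (N ∷ p) P

flat-solo : ∀ {q s s′ a a′ b b′ c c′ U} {t : Maybe Ty} →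
            s ≡ s′ → t ≡ just U → a ≡ a′ → b ≡ b′ → c ≡ c′ →
            record { pol = q ; subj = s ; sty = t ; obj = triple a b c } ≡ mkSolo q s′ U a′ b′ c′
flat-solo refl refl refl refl refl = refl

max-u : ∀ u x P → u ≤ u ⊔ x ⊔ maxName P
max-u u x P = ≤-trans (m≤m⊔n u x) (m≤m⊔n (u ⊔ x) (maxName P))

max-x : ∀ u x P → x ≤ u ⊔ x ⊔ maxName P
max-x u x P = ≤-trans (m≤n⊔m u x) (m≤m⊔n (u ⊔ x) (maxName P))

max-P : ∀ u x P → maxName P ≤ u ⊔ x ⊔ maxName P
max-P u x P = m≤n⊔m (u ⊔ x) (maxName P)

module _ (u x : Name) (P : Pi) {v k : ℕ} (m<v : u ⊔ x ⊔ maxName P < v) (v<k : v < k) where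

  u<k : u < k
  u<k = <-trans (≤-<-trans (max-u u x P) m<v) v<k

  x<k : x < k
  x<k = <-trans (≤-<-trans (max-x u x P) m<v) v<k

  x<v : x < v
  x<v = ≤-<-trans (max-x u x P) m<v

  P<k : maxName P < k
  P<k = <-trans (≤-<-trans (max-P u x P) m<v) v<k

tr-counter : ∀ P v k → k ≤ proj₂ (tr P v k)
tr-counter nil v k = ≤-refl
tr-counter (inp u x P) v k
  with tr P (suc (suc (suc k))) (suc (suc (suc (suc k))))
     | tr-counter P (suc (suc (suc k))) (suc (suc (suc (suc k))))
... | _ , _ | k₄≤k′ = m+n≤o⇒n≤o 4 k₄≤k′
tr-counter (out u x P) v k
  with tr P (suc (suc (suc k))) (suc (suc (suc (suc k))))
     | tr-counter P (suc (suc (suc k))) (suc (suc (suc (suc k))))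
... | _ , _ | k₄≤k′ = m+n≤o⇒n≤o 4 k₄≤k′
tr-counter (par P Q) v k with tr P v k | tr-counter P v k
... | _ , k₁ | k≤k₁ with tr Q v k₁ | tr-counter Q v k₁
... | _ , _ | k₁≤k₂ = ≤-trans k≤k₁ k₁≤k₂
tr-counter (nu x P) v k with tr P v k | tr-counter P v k
... | _ , _ | k≤k′ = k≤k′

handshake : Name → Name → ℕ → Sol → Sol
handshake v u k B = nu k W (nu (suc k) V (par (solo Out v u k (suc k)) (par (C (2 + k) (suc k)) B)))

flatten-C : ∀ {ρ τ p z y c} → y ≢ z → ρ y ≡ c → τ y ≡ just V →
            flatten ρ τ p (C z y) ≡ mkSolo In c V (bd p) (bd p) c ∷ []
flatten-C {ρ} {τ} {p} {z} y≢z ρy τy =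
  cong (_∷ []) (flat-solo (trans (upd-≢ ρ _ y≢z) ρy) (trans (upd-≢ τ _ y≢z) τy)
                          (upd-≡ ρ z _) (upd-≡ ρ z _) (trans (upd-≢ ρ _ y≢z) ρy))

flatten-handshake : ∀ {ρ τ p v u k a T} B → v < k → u < k → τ v ≡ just V → ρ u ≡ a →
  flatten (hsEnv ρ k (bd p) (bd (yPos ++ p))) (hsEnv τ k (just W) (just V)) (bodyPos ++ p) B ≡ T →
  flatten ρ τ p (handshake v u k B) ≡ sendSolo (ρ v) a p ∷ ySolo p ∷ T
flatten-handshake {ρ} {τ} {p} {k = k} B v<k u<k τv ρu body =
  cong₂ _∷_ (flat-solo (hs-old ρ k _ _ v<k) (trans (hs-old τ k _ _ v<k) τv) (trans (hs-old ρ k _ _ u<k) ρu)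
                       (hs-w ρ k _ _) (hs-y ρ k _ _))
            (cong₂ _++_ (flatten-C {hsEnv ρ k (bd p) (bd (yPos ++ p))} {hsEnv τ k (just W) (just V)}
                                   {zPos ++ p} {2 + k} (<⇒≢ (n<1+n _)) (hs-y ρ k _ _) (hs-y τ k _ _))
                        body)

flatten-tr : ∀ P {ρ σ τ v k p} → maxName P < v → v < k → τ v ≡ just V → Agree (maxName P) ρ σ →
             flatten ρ τ p (proj₁ (tr P v k)) ≡ solosTr σ (ρ v) p P
flatten-tr nil m<v v<k τv ag = refl
flatten-tr (inp u x P) {ρ} {σ} {τ} {v} {k} {p} m<v v<k τv ag
  with tr P (suc (suc (suc k))) (suc (suc (suc (suc k))))
     | flatten-tr P {inEnv ρ k (bd p) (bd (yPos ++ p)) x (bd (bodyPos ++ p)) (bd (v′Pos ++ p))}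
                    {upd σ x (bd (bodyPos ++ p))} {inEnv τ k (just W) (just V) x (just W) (just V)}
                    {3 + k} {4 + k} {inContPos ++ p}
                    (below+ 3 (P<k u x P m<v v<k)) (n<1+n _) (in-v′ τ k _ _ _ _ (x<k u x P m<v v<k))
                    (in-agree (P<k u x P m<v v<k) (agree-mono (max-P u x P) ag))
... | Q , _ | ih =
  flatten-handshake {ρ} {τ} (nu x W (nu (3 + k) V (par (solo In k x v (3 + k)) Q)))
    v<k (u<k u x P m<v v<k) τv (ag u (max-u u x P))
    (cong₂ _∷_ (flat-solo (in-w ρ k _ _ _ _ x<k′) (in-w τ k _ _ _ _ x<k′) (in-x ρ k _ _ _ _ x<k′)
                          (in-old ρ k _ _ _ _ x<k′ v<k (x<v u x P m<v v<k)) (in-v′ ρ k _ _ _ _ x<k′))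
               (trans ih (cong (λ c → solosTr (upd σ x (bd (bodyPos ++ p))) c (inContPos ++ p) P)
                                (in-v′ ρ k _ _ _ _ x<k′))))
  where
  x<k′ : x < k
  x<k′ = x<k u x P m<v v<k
flatten-tr (out u x P) {ρ} {σ} {τ} {v} {k} {p} m<v v<k τv ag
  with tr P (suc (suc (suc k))) (suc (suc (suc (suc k))))
     | flatten-tr P {outEnv ρ k (bd p) (bd (yPos ++ p)) (bd (bodyPos ++ p))} {σ}
                    {outEnv τ k (just W) (just V) (just V)} {3 + k} {4 + k} {outContPos ++ p}
                    (below+ 3 (P<k u x P m<v v<k)) (n<1+n _) (out-v′ τ k _ _ _)
                    (out-agree (P<k u x P m<v v<k) (agree-mono (max-P u x P) ag))
... | Q , _ | ih =
  flatten-handshake {ρ} {τ} (nu (3 + k) V (par (solo Out k x (3 + k) v) Q))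
    v<k (u<k u x P m<v v<k) τv (ag u (max-u u x P))
    (cong₂ _∷_ (flat-solo (out-w ρ k _ _ _) (out-w τ k _ _ _)
                          (trans (out-old ρ k _ _ _ (x<k u x P m<v v<k)) (ag x (max-x u x P)))
                          (out-v′ ρ k _ _ _) (out-old ρ k _ _ _ v<k))
               (trans ih (cong (λ c → solosTr σ c (outContPos ++ p) P) (out-v′ ρ k _ _ _))))
flatten-tr (par P Q) {v = v} {k} {p} m<v v<k τv ag
  with tr P v k | tr-counter P v k
     | flatten-tr P {p = L ∷ p} (≤-<-trans (m≤m⊔n _ _) m<v) v<k τv (agree-mono (m≤m⊔n _ _) ag)
... | P′ , k₁ | k≤k₁ | ihP
  with tr Q v k₁
     | flatten-tr Q {p = Rt ∷ p} (≤-<-trans (m≤n⊔m _ _) m<v) (<-≤-trans v<k k≤k₁) τv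
                    (agree-mono (m≤n⊔m _ _) ag)
... | Q′ , _ | ihQ = cong₂ _++_ ihP ihQ
flatten-tr (nu x P) {ρ} {σ} {τ} {v} {k} {p} m<v v<k τv ag
  with tr P v k
     | flatten-tr P {upd ρ x (bd p)} {upd σ x (bd p)} {τ ,, x ∶ W} {p = N ∷ p}
                    (≤-<-trans (m≤n⊔m x _) m<v) v<k (trans (upd-> τ _ (≤-<-trans (m≤m⊔n x _) m<v)) τv)
                    (agree-upd x _ (agree-mono (m≤n⊔m x _) ag))
... | P′ , _ | ih =
  trans ih (cong (λ c → solosTr (upd σ x (bd p)) c (N ∷ p) P) (upd-> ρ _ (≤-<-trans (m≤m⊔n x _) m<v)))

-- Typing

free-≤ : ∀ P n → T (isFree P n) → n ≤ maxName P
free-≤ nil n ()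
free-≤ (inp u x P) n h with to T-∨ h
... | inj₁ n≡u = ≤-trans (≤-reflexive (≡ᵇ⇒≡ n u n≡u)) (max-u u x P)
... | inj₂ h′ with n ≡ᵇ x
...   | true  = ⊥-elim h′
...   | false = ≤-trans (free-≤ P n h′) (max-P u x P)
free-≤ (out u x P) n h with to T-∨ h
... | inj₁ n≡u = ≤-trans (≤-reflexive (≡ᵇ⇒≡ n u n≡u)) (max-u u x P)
... | inj₂ h′ with to T-∨ h′
...   | inj₁ n≡x = ≤-trans (≤-reflexive (≡ᵇ⇒≡ n x n≡x)) (max-x u x P)
...   | inj₂ h″  = ≤-trans (free-≤ P n h″) (max-P u x P)
free-≤ (par P Q) n h with to T-∨ h
... | inj₁ h′ = ≤-trans (free-≤ P n h′) (m≤m⊔n _ _)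
... | inj₂ h′ = ≤-trans (free-≤ Q n h′) (m≤n⊔m _ _)
free-≤ (nu x P) n h with n ≡ᵇ x
... | true  = ⊥-elim h
... | false = ≤-trans (free-≤ P n h) (m≤n⊔m x _)

free-inp : ∀ u x P {n} → n ≢ x → T (isFree P n) → T (isFree (inp u x P) n)
free-inp u x P {n} n≢x h with n ≡ᵇ x | ≡ᵇ⇒≡ n x
... | true  | n≡x = ⊥-elim (n≢x (n≡x _))
... | false | _   = from T-∨ (inj₂ h)

free-inp-u : ∀ u x P → T (isFree (inp u x P) u)
free-inp-u u x P = from T-∨ (inj₁ (≡⇒≡ᵇ u u refl))

free-out : ∀ u x P {n} → T (isFree P n) → T (isFree (out u x P) n)
free-out u x P {n} h = from (T-∨ {n ≡ᵇ u}) (inj₂ (from (T-∨ {n ≡ᵇ x}) (inj₂ h)))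

free-out-u : ∀ u x P → T (isFree (out u x P) u)
free-out-u u x P = from T-∨ (inj₁ (≡⇒≡ᵇ u u refl))

free-out-x : ∀ u x P → T (isFree (out u x P) x)
free-out-x u x P = from (T-∨ {x ≡ᵇ u}) (inj₂ (from T-∨ (inj₁ (≡⇒≡ᵇ x x refl))))

free-par-l : ∀ P Q {n} → T (isFree P n) → T (isFree (par P Q) n)
free-par-l P Q h = from T-∨ (inj₁ h)

free-par-r : ∀ P Q {n} → T (isFree Q n) → T (isFree (par P Q) n)
free-par-r P Q h = from T-∨ (inj₂ h)

free-nu : ∀ x P {n} → n ≢ x → T (isFree P n) → T (isFree (nu x P) n)
free-nu x P {n} n≢x h with n ≡ᵇ x | ≡ᵇ⇒≡ n x
... | true  | n≡x = ⊥-elim (n≢x (n≡x _))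
... | false | _   = h

FreeW : Pi → Env → Set
FreeW P τ = ∀ n → T (isFree P n) → τ n ≡ just W

freeW-agree : ∀ P {τ τ′} → Agree (maxName P) τ τ′ → FreeW P τ′ → FreeW P τ
freeW-agree P ag fw n h = trans (ag n (free-≤ P n h)) (fw n h)

freeW-bind : ∀ P {τ x} → (∀ n → n ≢ x → T (isFree P n) → τ n ≡ just W) → FreeW P (upd τ x (just W))
freeW-bind P {τ} {x} fw n h with n ≡ᵇ x | ≡⇒≡ᵇ n x
... | true  | _   = refl
... | false | n≢x = fw n n≢x h

C-typed : ∀ {Γ z y} → y ≢ z → Γ y ≡ just V → Γ ⊢ C z y
C-typed {Γ} {z} y≢z Γy =
  t-nu (t-solo (shapeVWWV (trans (upd-≢ Γ _ y≢z) Γy) (upd-≡ Γ z _) (upd-≡ Γ z _)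
                          (trans (upd-≢ Γ _ y≢z) Γy)))

handshake-typed : ∀ {τ v u k} B → v < k → u < k → τ v ≡ just V → τ u ≡ just W →
                  hsEnv τ k (just W) (just V) ⊢ B → τ ⊢ handshake v u k B
handshake-typed {τ} {k = k} B v<k u<k τv τu ⊢B =
  t-nu (t-nu (t-par (t-solo (shapeVWWV (trans (hs-old τ k _ _ v<k) τv) (trans (hs-old τ k _ _ u<k) τu)
                                       (hs-w τ k _ _) (hs-y τ k _ _)))
                    (t-par (C-typed (<⇒≢ (n<1+n _)) (hs-y τ k _ _)) ⊢B)))

tr-typed : ∀ P {τ v k} → maxName P < v → v < k → τ v ≡ just V → FreeW P τ → τ ⊢ proj₁ (tr P v k)
tr-typed nil m<v v<k τv fw = t-nil
tr-typed (inp u x P) {τ} {v} {k} m<v v<k τv fw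
  with tr P (suc (suc (suc k))) (suc (suc (suc (suc k))))
     | tr-typed P {inEnv τ k (just W) (just V) x (just W) (just V)} {3 + k} {4 + k}
                  (below+ 3 (P<k u x P m<v v<k)) (n<1+n _) (in-v′ τ k _ _ _ _ (x<k u x P m<v v<k))
                  (freeW-agree P (in-agree (P<k u x P m<v v<k) (λ _ _ → refl))
                                 (freeW-bind P (λ n n≢x h → fw n (free-inp u x P n≢x h))))
... | Q , _ | ⊢Q =
  handshake-typed {τ} (nu x W (nu (3 + k) V (par (solo In k x v (3 + k)) Q)))
    v<k (u<k u x P m<v v<k) τv (fw u (free-inp-u u x P))
    (t-nu (t-nu (t-par (t-solo (shapeWWVV (in-w τ k _ _ _ _ x<k′) (in-x τ k _ _ _ _ x<k′)
                                          (trans (in-old τ k _ _ _ _ x<k′ v<k (x<v u x P m<v v<k)) τv)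
                                          (in-v′ τ k _ _ _ _ x<k′)))
                       ⊢Q)))
  where
  x<k′ : x < k
  x<k′ = x<k u x P m<v v<k
tr-typed (out u x P) {τ} {v} {k} m<v v<k τv fw
  with tr P (suc (suc (suc k))) (suc (suc (suc (suc k))))
     | tr-typed P {outEnv τ k (just W) (just V) (just V)} {3 + k} {4 + k}
                  (below+ 3 (P<k u x P m<v v<k)) (n<1+n _) (out-v′ τ k _ _ _)
                  (freeW-agree P (out-agree (P<k u x P m<v v<k) (λ _ _ → refl))
                                 (λ n h → fw n (free-out u x P h)))
... | Q , _ | ⊢Q =
  handshake-typed {τ} (nu (3 + k) V (par (solo Out k x (3 + k) v) Q))
    v<k (u<k u x P m<v v<k) τv (fw u (free-out-u u x P))
    (t-nu (t-par (t-solo (shapeWWVV (out-w τ k _ _ _)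
                                    (trans (out-old τ k _ _ _ (x<k u x P m<v v<k)) (fw x (free-out-x u x P)))
                                    (out-v′ τ k _ _ _) (trans (out-old τ k _ _ _ v<k) τv)))
                 ⊢Q))
tr-typed (par P Q) {v = v} {k} m<v v<k τv fw
  with tr P v k | tr-counter P v k
     | tr-typed P (≤-<-trans (m≤m⊔n _ _) m<v) v<k τv (λ n h → fw n (free-par-l P Q h))
... | P′ , k₁ | k≤k₁ | ⊢P
  with tr Q v k₁
     | tr-typed Q (≤-<-trans (m≤n⊔m _ _) m<v) (<-≤-trans v<k k≤k₁) τv (λ n h → fw n (free-par-r P Q h))
... | Q′ , _ | ⊢Q = t-par ⊢P ⊢Q
tr-typed (nu x P) {τ} {v} {k} m<v v<k τv fw
  with tr P v k
     | tr-typed P {τ ,, x ∶ W} (≤-<-trans (m≤n⊔m x _) m<v) v<k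
                  (trans (upd-> τ _ (≤-<-trans (m≤m⊔n x _) m<v)) τv)
                  (freeW-bind P (λ n n≢x h → fw n (free-nu x P n≢x h)))
... | P′ , _ | ⊢P = t-nu ⊢P

-- Scopes: where a resolved name is bound

-- Below p g: g is bound at position p or inside the subterm at p.
Below : List Dir → GN → Set
Below p (fr _) = ⊥
Below p (bd q) = Suffix _≡_ p q

inside : ∀ e p → Suffix _≡_ p (e ++ p)
inside e p = ∣ʳ-as-Suffix {A = Dir} record { quotient = e ; equality = refl }

below-trans : ∀ {p q} g → Suffix _≡_ p q → Below q g → Below p g
below-trans (bd r) p⊑q q⊑r = Suffix.trans trans p⊑q q⊑r

not-below-shorter : ∀ e f {p} {_ : True (length e <? length f)} → ¬ Below (f ++ p) (bd (e ++ p))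
not-below-shorter e f {p} {e<f} f⊑e = <⇒≱ shorter (Suffix.length-mono f⊑e)
  where
  shorter : length (e ++ p) < length (f ++ p)
  shorter rewrite length-++ e {p} | length-++ f {p} = +-monoˡ-< (length p) (toWitness e<f)

siblings : ∀ {d d′ p} g → d ≢ d′ → Below (d ∷ p) g → Below (d′ ∷ p) g → ⊥
siblings (bd q) d≢d′ d⊑q d′⊑q with Suffix-as-∣ʳ {A = Dir} d⊑q
... | record { quotient = cs ; equality = refl } with Suffix.++⁻ {as = []} {bs = cs} refl d′⊑q
...   | d′≡d ∷ _ = d≢d′ (sym d′≡d)

-- Occurrences in resolved solos (these match Defs.Relations on indices)

Occurs : Proto → RSolo → Fin 3 → GN → Set
Occurs X t i g = obj t i ≡ g × protoAt t i ≡ just X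

_◃_ : RSolo → GN → Set
t ◃ g = ∃ λ i → Occurs R t i g

_∈ₒ_ : GN → RSolo → Set
g ∈ₒ t = ∃ λ i → obj t i ≡ g

-- The conditions of acyclicity that concern a single solo: a name is
-- received at most once by it (AC1) and a name it both sends and
-- receives forces it to be an input (AC4).
record Proper (t : RSolo) : Set where
  field
    receives-once : ∀ i j g → Occurs R t i g → Occurs R t j g → i ≡ j
    send-receive  : ∀ i g → Occurs S t i g → t ◃ g → pol t ≡ In

Apart : RSolo → RSolo → Set
Apart s t = ∀ g → s ◃ g → ¬ t ◃ g

apart-by : ∀ {s t} (B : GN → Set) → (∀ g → s ◃ g → ¬ B g) → (∀ g → t ◃ g → B g) → Apart s t
apart-by B s-out t-in g s◃g t◃g = s-out g s◃g (t-in g t◃g)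

data Reach (T : List RSolo) (s t : RSolo) : Set where
  direct : s ◃ subj t → Reach T s t
  via    : ∀ {r} → r ∈ T → s ◃ subj r → Reach T r t → Reach T s t

reach-mono : ∀ {T T′} → (∀ {r} → r ∈ T → r ∈ T′) → ∀ {s t} → Reach T s t → Reach T′ s t
reach-mono T⊆T′ (direct s◃t) = direct s◃t
reach-mono T⊆T′ (via r∈T s◃r r⇝t) = via (T⊆T′ r∈T) s◃r (reach-mono T⊆T′ r⇝t)

-- The invariant of the translation

-- The names a translated term inherits from its context: the channel c
-- and the resolutions σ of the source names.
External : (Name → GN) → GN → GN → Set
External σ c g = g ≡ c ⊎ ∃ λ n → g ≡ σ n

-- Local σ c p t: solo t belongs to a translation at position p whose
-- context is σ, c.
record Local (σ : Name → GN) (c : GN) (p : List Dir) (t : RSolo) : Set where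
  field
    receives-below : ∀ g → t ◃ g → Below p g
    objects        : ∀ g → g ∈ₒ t → External σ c g ⊎ Below p g
    subject        : (subj t ≡ c × pol t ≡ Out) ⊎ Below p (subj t)
    proper         : Proper t

record Inv (σ : Name → GN) (c : GN) (p : List Dir) (T : List RSolo) : Set where
  field
    local    : All (Local σ c p) T
    apart    : AllPairs Apart T
    polarity : ∀ {r r′} → r ∈ T → r′ ∈ T → pol r ≡ In → pol r′ ≡ Out → subj r ≢ subj r′
    closure  : ∀ {s t g} → s ∈ T → t ∈ T → s ◃ g → g ∈ₒ t → s ≡ t ⊎ Reach T s t
    channel  : ∀ {s t} → s ◃ c → t ∈ T → Reach T s t

open Local
open Inv

Outside : (Name → GN) → GN → List Dir → Set
Outside σ c p = (∀ n → ¬ Below p (σ n)) × ¬ Below p c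

external-outside : ∀ {σ c p g} → Outside σ c p → External σ c g → ¬ Below p g
external-outside (σ-out , c-out) (inj₁ refl)       = c-out
external-outside (σ-out , c-out) (inj₂ (n , refl)) = σ-out n

In≢Out : In ≢ Out
In≢Out ()

input-subject : ∀ {σ c p t} → Local σ c p t → pol t ≡ In → Below p (subj t)
input-subject l t-in with subject l
... | inj₁ (_ , t-out) = ⊥-elim (In≢Out (trans (sym t-in) t-out))
... | inj₂ s⊑p = s⊑p

widen : ∀ {σ σ′ c c′ p q t} → Suffix _≡_ p q → (c′ ≡ c ⊎ Below p c′) →
        (∀ n → σ′ n ≡ σ n ⊎ Below p (σ′ n)) → Local σ′ c′ q t → Local σ c p t
widen {σ} {σ′} {c} {c′} {p} {q} {t} p⊑q chan names l = record
  { receives-below = λ g t◃g → below-trans g p⊑q (receives-below l g t◃g)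
  ; objects        = λ g g∈t → object (objects l g g∈t)
  ; subject        = subject′ (subject l)
  ; proper         = proper l }
  where
  channel′ : c′ ≡ c ⊎ Below p c′ → External σ c c′ ⊎ Below p c′
  channel′ (inj₁ c′≡c) = inj₁ (inj₁ c′≡c)
  channel′ (inj₂ c′⊑p) = inj₂ c′⊑p
  name : ∀ n → σ′ n ≡ σ n ⊎ Below p (σ′ n) → External σ c (σ′ n) ⊎ Below p (σ′ n)
  name n (inj₁ σ′n≡σn) = inj₁ (inj₂ (n , σ′n≡σn))
  name n (inj₂ σ′n⊑p)  = inj₂ σ′n⊑p
  object : ∀ {g} → External σ′ c′ g ⊎ Below q g → External σ c g ⊎ Below p g
  object (inj₁ (inj₁ refl))       = channel′ chan
  object (inj₁ (inj₂ (n , refl))) = name n (names n)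
  object (inj₂ g⊑q)               = inj₂ (below-trans _ p⊑q g⊑q)
  output : c′ ≡ c ⊎ Below p c′ → subj t ≡ c′ → pol t ≡ Out →
           (subj t ≡ c × pol t ≡ Out) ⊎ Below p (subj t)
  output (inj₁ c′≡c) s≡c′ t-out = inj₁ (trans s≡c′ c′≡c , t-out)
  output (inj₂ c′⊑p) s≡c′ t-out = inj₂ (subst (Below p) (sym s≡c′) c′⊑p)
  subject′ : (subj t ≡ c′ × pol t ≡ Out) ⊎ Below q (subj t) →
             (subj t ≡ c × pol t ≡ Out) ⊎ Below p (subj t)
  subject′ (inj₁ (s≡c′ , t-out)) = output chan s≡c′ t-out
  subject′ (inj₂ s⊑q)            = inj₂ (below-trans (subj t) p⊑q s⊑q)

inv-nil : ∀ {σ c p} → Inv σ c p []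
inv-nil = record { local = [] ; apart = [] ; polarity = λ () ; closure = λ () ; channel = λ _ () }

-- (ν x) P at position p: x resolves to the binder at p itself.
inv-nu : ∀ {σ c p x T} → Inv (upd σ x (bd p)) c (N ∷ p) T → Inv σ c p T
inv-nu {σ} {p = p} {x} I = record
  { local    = All.map (widen (inside (N ∷ []) p) (inj₁ refl) bound) (local I)
  ; apart    = apart I
  ; polarity = polarity I
  ; closure  = closure I
  ; channel  = channel I }
  where
  bound : ∀ n → upd σ x (bd p) n ≡ σ n ⊎ Below p (upd σ x (bd p) n)
  bound n with n ≡ᵇ x
  ... | true  = inj₂ (inside [] p)
  ... | false = inj₁ refl

module Siblings {σ c p d d′} (away : Outside σ c p) (d≢d′ : d ≢ d′) {s t : RSolo}
                (ls : Local σ c (d ∷ p) s) (lt : Local σ c (d′ ∷ p) t) where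

  bound-outside : ∀ g → Below (d ∷ p) g → ¬ Below p g → ⊥
  bound-outside g g⊑ g⋢p = g⋢p (below-trans g (inside (d ∷ []) p) g⊑)

  apart′ : Apart s t
  apart′ = apart-by (Below (d′ ∷ p)) (λ g s◃g → siblings g d≢d′ (receives-below ls g s◃g))
                    (receives-below lt)

  unlinked : ∀ {g} → s ◃ g → ¬ g ∈ₒ t
  unlinked {g} s◃g g∈t with objects lt g g∈t
  ... | inj₁ ext = bound-outside g (receives-below ls g s◃g) (external-outside away ext)
  ... | inj₂ g⊑  = siblings g d≢d′ (receives-below ls g s◃g) g⊑

  no-clash : pol s ≡ In → subj s ≢ subj t
  no-clash s-in s≡t with subject lt
  ... | inj₁ (t≡c , _) = bound-outside (subj s) (input-subject ls s-in)
                                       (subst (λ g → ¬ Below p g) (sym (trans s≡t t≡c)) (proj₂ away))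
  ... | inj₂ t⊑ = siblings (subj s) d≢d′ (input-subject ls s-in) (subst (Below (d′ ∷ p)) (sym s≡t) t⊑)

inv-par : ∀ {σ c p T₁ T₂} → Outside σ c p → Inv σ c (L ∷ p) T₁ → Inv σ c (Rt ∷ p) T₂ →
          Inv σ c p (T₁ ++ T₂)
inv-par {σ} {c} {p} {T₁} {T₂} away I₁ I₂ = record
  { local    = All.++⁺ (All.map (widen (inside (L ∷ []) p) (inj₁ refl) (λ _ → inj₁ refl)) (local I₁))
                       (All.map (widen (inside (Rt ∷ []) p) (inj₁ refl) (λ _ → inj₁ refl)) (local I₂))
  ; apart    = AllPairs.++⁺ (apart I₁) (apart I₂)
                 (All.tabulate λ t₁∈ → All.tabulate λ t₂∈ →
                    Siblings.apart′ away (λ ()) (local₁ t₁∈) (local₂ t₂∈))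
  ; polarity = polarity′
  ; closure  = closure′
  ; channel  = channel′ }
  where
  T₁₂ : List RSolo
  T₁₂ = T₁ ++ T₂
  local₁ : ∀ {t} → t ∈ T₁ → Local σ c (L ∷ p) t
  local₁ = All.lookup (local I₁)
  local₂ : ∀ {t} → t ∈ T₂ → Local σ c (Rt ∷ p) t
  local₂ = All.lookup (local I₂)
  left : ∀ {t} → t ∈ T₁ → t ∈ T₁₂
  left = ∈-++⁺ˡ
  right : ∀ {t} → t ∈ T₂ → t ∈ T₁₂
  right = ∈-++⁺ʳ T₁

  polarity′ : ∀ {r r′} → r ∈ T₁₂ → r′ ∈ T₁₂ → pol r ≡ In → pol r′ ≡ Out → subj r ≢ subj r′
  polarity′ r∈ r′∈ r-in r′-out with ∈-++⁻ T₁ r∈ | ∈-++⁻ T₁ r′∈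
  ... | inj₁ a | inj₁ b = polarity I₁ a b r-in r′-out
  ... | inj₂ a | inj₂ b = polarity I₂ a b r-in r′-out
  ... | inj₁ a | inj₂ b = Siblings.no-clash away (λ ()) (local₁ a) (local₂ b) r-in
  ... | inj₂ a | inj₁ b = Siblings.no-clash away (λ ()) (local₂ a) (local₁ b) r-in

  closure′ : ∀ {s t g} → s ∈ T₁₂ → t ∈ T₁₂ → s ◃ g → g ∈ₒ t → s ≡ t ⊎ Reach T₁₂ s t
  closure′ s∈ t∈ s◃g g∈t with ∈-++⁻ T₁ s∈ | ∈-++⁻ T₁ t∈
  ... | inj₁ a | inj₁ b = map₂ (reach-mono left) (closure I₁ a b s◃g g∈t)
  ... | inj₂ a | inj₂ b = map₂ (reach-mono right) (closure I₂ a b s◃g g∈t)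
  ... | inj₁ a | inj₂ b = ⊥-elim (Siblings.unlinked away (λ ()) (local₁ a) (local₂ b) s◃g g∈t)
  ... | inj₂ a | inj₁ b = ⊥-elim (Siblings.unlinked away (λ ()) (local₂ a) (local₁ b) s◃g g∈t)

  channel′ : ∀ {s t} → s ◃ c → t ∈ T₁₂ → Reach T₁₂ s t
  channel′ s◃c t∈ with ∈-++⁻ T₁ t∈
  ... | inj₁ a = reach-mono left (channel I₁ s◃c a)
  ... | inj₂ b = reach-mono right (channel I₂ s◃c b)

received-object : ∀ {t g} → t ◃ g → g ∈ₒ t
received-object (i , g≡ , _) = i , g≡

-- Requirements on the third solo s of a prefix translated at position p
-- (the solo on w = bd p), when the continuation is translated at q,
-- inside the body position b = bodyPos ++ p, with context σ′ and c′:
-- s receives only names bound in the body but outside q, among them c′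
-- and the names that σ′ adds to σ, and mentions nothing else except
-- context names.
record Body (σ : Name → GN) (c : GN) (p : List Dir) (σ′ : Name → GN) (c′ : GN) (q : List Dir)
            (s : RSolo) : Set where
  field
    on-w          : subj s ≡ bd p
    proper-s      : Proper s
    cont-inside   : Suffix _≡_ (bodyPos ++ p) q
    receives-body : ∀ g → s ◃ g → Below (bodyPos ++ p) g × ¬ Below q g
    objects-s     : ∀ g → g ∈ₒ s → External σ c g ⊎ s ◃ g
    receives-c′   : s ◃ c′
    context       : ∀ n → σ′ n ≡ σ n ⊎ s ◃ σ′ n

-- A prefix at position p: the handshake solos s₁ = v̄⟨u w y⟩ and
-- s₂ = C(y), the body solo s, and the continuation T′.  The handshake
-- names w, y, z are bound outside the body, so apart from s₁ ◃ w = subj s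
-- and s₁ ◃ y = subj s₂ nothing links them to s and T′; s₁ reaches the
-- whole prefix through s ◃ c′.
module Prefix {σ c p} (away : Outside σ c p) (u : Name) {σ′ c′ q s} (B : Body σ c p σ′ c′ q s)
              {T′} (I : Inv σ′ c′ q T′) where
  open Body B

  b : List Dir
  b = bodyPos ++ p

  s₁ s₂ : RSolo
  s₁ = sendSolo c (σ u) p
  s₂ = ySolo p

  Ts : List RSolo
  Ts = s₁ ∷ s₂ ∷ s ∷ T′

  cont : ∀ {t} → t ∈ T′ → t ∈ Ts
  cont m = there (there (there m))

  deep : ∀ {g} → Below q g → Below b g
  deep = below-trans _ cont-inside

  z⊑ : Below (zPos ++ p) (bd (zPos ++ p))
  z⊑ = inside [] (zPos ++ p)

  z⋢b : ¬ Below b (bd (zPos ++ p))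
  z⋢b = siblings (bd (zPos ++ p)) (λ ()) z⊑

  s₁-objects : ∀ {g} → g ∈ₒ s₁ → ¬ Below b g × ¬ Below (zPos ++ p) g
  s₁-objects (zero , refl)           = σu⋢ bodyPos , σu⋢ zPos
    where σu⋢ : ∀ e → ¬ Below (e ++ p) (σ u)
          σu⋢ e σu⊑ = proj₁ away u (below-trans (σ u) (inside e p) σu⊑)
  s₁-objects (suc zero , refl)       = not-below-shorter [] bodyPos , not-below-shorter [] zPos
  s₁-objects (suc (suc zero) , refl) = not-below-shorter yPos bodyPos , not-below-shorter yPos zPos

  s₂-objects : ∀ {g} → g ∈ₒ s₂ → ¬ Below b g
  s₂-objects (zero , refl)           = z⋢b
  s₂-objects (suc zero , refl)       = z⋢b
  s₂-objects (suc (suc zero) , refl) = not-below-shorter yPos bodyPos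

  s₂-receives : ∀ {g} → s₂ ◃ g → Below (zPos ++ p) g
  s₂-receives (zero , refl , _) = z⊑
  s₂-receives (suc zero , _ , ())
  s₂-receives (suc (suc zero) , _ , ())

  s-objects : ∀ {g} → g ∈ₒ s → ¬ Below p g ⊎ (Below b g × ¬ Below q g)
  s-objects {g} g∈s with objects-s g g∈s
  ... | inj₁ ext = inj₁ (external-outside away ext)
  ... | inj₂ s◃g = inj₂ (receives-body g s◃g)

  c′-deep : Below b c′
  c′-deep = proj₁ (receives-body c′ receives-c′)

  context-deep : ∀ n → σ′ n ≡ σ n ⊎ Below b (σ′ n)
  context-deep n with context n
  ... | inj₁ σ′n≡σn = inj₁ σ′n≡σn
  ... | inj₂ s◃σ′n  = inj₂ (proj₁ (receives-body (σ′ n) s◃σ′n))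

  local′ : ∀ {t} → t ∈ T′ → Local σ′ c′ q t
  local′ = All.lookup (local I)

  cont-objects : ∀ {t g} → t ∈ T′ → g ∈ₒ t → ¬ Below p g ⊎ Below b g
  cont-objects {t} {g} m g∈t with objects (local′ m) g g∈t
  ... | inj₁ (inj₁ refl)       = inj₂ c′-deep
  ... | inj₁ (inj₂ (n , refl)) with context-deep n
  ...   | inj₁ σ′n≡σn = inj₁ (subst (λ h → ¬ Below p h) (sym σ′n≡σn) (proj₁ away n))
  ...   | inj₂ σ′n⊑b  = inj₂ σ′n⊑b
  cont-objects m g∈t | inj₂ g⊑q = inj₂ (deep g⊑q)

  cont-subject : ∀ {t} → t ∈ T′ → Below b (subj t)
  cont-subject {t} m with subject (local′ m)
  ... | inj₁ (t≡c′ , _) = subst (Below b) (sym t≡c′) c′-deep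
  ... | inj₂ t⊑q        = deep t⊑q

  s₁◃y : s₁ ◃ subj s₂
  s₁◃y = suc (suc zero) , refl , refl

  s₁◃w : s₁ ◃ subj s
  s₁◃w = subst (s₁ ◃_) (sym on-w) (suc zero , refl , refl)

  w⋢b : ¬ Below b (subj s)
  w⋢b = subst (λ g → ¬ Below b g) (sym on-w) (not-below-shorter [] bodyPos)

  s₁-reaches : ∀ {t} → t ∈ s₂ ∷ s ∷ T′ → Reach Ts s₁ t
  s₁-reaches (here refl)                = direct s₁◃y
  s₁-reaches (there (here refl))        = direct s₁◃w
  s₁-reaches (there (there m))          = via (there (there (here refl))) s₁◃w
                                              (reach-mono cont (channel I receives-c′ m))

  s₁-local : Local σ c p s₁
  s₁-local = record
    { receives-below = λ { g (suc zero , refl , _) → inside [] p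
                         ; g (suc (suc zero) , refl , _) → inside yPos p
                         ; g (zero , _ , ()) }
    ; objects        = λ { g (zero , refl) → inj₁ (inj₂ (u , refl))
                         ; g (suc zero , refl) → inj₂ (inside [] p)
                         ; g (suc (suc zero) , refl) → inj₂ (inside yPos p) }
    ; subject        = inj₁ (refl , refl)
    ; proper         = record { receives-once = once ; send-receive = send-receive′ } }
    where
    w≢y : bd p ≢ bd (yPos ++ p)
    w≢y w≡y = not-below-shorter [] yPos (subst (Below (yPos ++ p)) (sym w≡y) (inside [] (yPos ++ p)))
    once : ∀ i j g → Occurs R s₁ i g → Occurs R s₁ j g → i ≡ j
    once zero _ _ (_ , ()) _
    once _ zero _ _ (_ , ())
    once (suc zero)       (suc zero)       _ _ _ = refl
    once (suc (suc zero)) (suc (suc zero)) _ _ _ = refl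
    once (suc zero)       (suc (suc zero)) _ (refl , _) (w≡y , _) = ⊥-elim (w≢y (sym w≡y))
    once (suc (suc zero)) (suc zero)       _ (refl , _) (y≡w , _) = ⊥-elim (w≢y y≡w)
    send-receive′ : ∀ i g → Occurs S s₁ i g → s₁ ◃ g → pol s₁ ≡ In
    send-receive′ zero g (refl , _) (suc zero , w≡ , _) =
      ⊥-elim (proj₁ away u (subst (Below p) w≡ (inside [] p)))
    send-receive′ zero g (refl , _) (suc (suc zero) , y≡ , _) =
      ⊥-elim (proj₁ away u (subst (Below p) y≡ (inside yPos p)))
    send-receive′ zero g _ (zero , _ , ())
    send-receive′ (suc zero) g (_ , ()) _
    send-receive′ (suc (suc zero)) g (_ , ()) _

  s₂-local : Local σ c p s₂
  s₂-local = record
    { receives-below = λ g s₂◃g → below-trans g (inside zPos p) (s₂-receives s₂◃g)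
    ; objects        = λ { g (zero , refl) → inj₂ (inside zPos p)
                         ; g (suc zero , refl) → inj₂ (inside zPos p)
                         ; g (suc (suc zero) , refl) → inj₂ (inside yPos p) }
    ; subject        = inj₂ (inside yPos p)
    ; proper         = record { receives-once = once ; send-receive = λ _ _ _ _ → refl } }
    where
    once : ∀ i j g → Occurs R s₂ i g → Occurs R s₂ j g → i ≡ j
    once zero zero _ _ _ = refl
    once (suc zero) _ _ (_ , ()) _
    once (suc (suc zero)) _ _ (_ , ()) _
    once zero (suc zero) _ _ (_ , ())
    once zero (suc (suc zero)) _ _ (_ , ())

  s-local : Local σ c p s
  s-local = record
    { receives-below = λ g s◃g → below-trans g (inside bodyPos p) (proj₁ (receives-body g s◃g))
    ; objects        = object
    ; subject        = inj₂ (subst (Below p) (sym on-w) (inside [] p))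
    ; proper         = proper-s }
    where
    object : ∀ g → g ∈ₒ s → External σ c g ⊎ Below p g
    object g g∈s with objects-s g g∈s
    ... | inj₁ ext = inj₁ ext
    ... | inj₂ s◃g = inj₂ (below-trans g (inside bodyPos p) (proj₁ (receives-body g s◃g)))

  local″ : All (Local σ c p) Ts
  local″ = s₁-local ∷ s₂-local ∷ s-local
         ∷ All.map (widen (Suffix.trans trans (inside bodyPos p) cont-inside)
                          (inj₂ (below-trans c′ (inside bodyPos p) c′-deep))
                          (λ n → map₂ (below-trans (σ′ n) (inside bodyPos p)) (context-deep n)))
                   (local I)

  s-receives : ∀ g → s ◃ g → Below b g
  s-receives g s◃g = proj₁ (receives-body g s◃g)

  cont-receives : ∀ {t} → t ∈ T′ → ∀ g → t ◃ g → Below b g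
  cont-receives m g t◃g = deep (receives-below (local′ m) g t◃g)

  s₁-apart : ∀ {t} → (∀ g → t ◃ g → Below b g) → Apart s₁ t
  s₁-apart = apart-by {s₁} (Below b) (λ g s₁◃g → proj₁ (s₁-objects (received-object {s₁} s₁◃g)))

  s₂-apart : ∀ {t} → (∀ g → t ◃ g → Below b g) → Apart s₂ t
  s₂-apart = apart-by {s₂} (Below b) (λ g s₂◃g → s₂-objects (received-object {s₂} s₂◃g))

  apart′ : AllPairs Apart Ts
  apart′ = (apart-by {s₁} {s₂} (Below (zPos ++ p)) (λ g s₁◃g → proj₂ (s₁-objects (received-object {s₁} s₁◃g)))
                                                    (λ g → s₂-receives)
             ∷ s₁-apart s-receives ∷ All.tabulate (λ m → s₁-apart (cont-receives m)))
         ∷ (s₂-apart s-receives ∷ All.tabulate (λ m → s₂-apart (cont-receives m)))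
         ∷ All.tabulate (λ m → apart-by {s} (Below q) (λ g s◃g → proj₂ (receives-body g s◃g))
                                                      (receives-below (local′ m)))
         ∷ apart I

  -- s₂ receives only z, bound in the handshake but outside the body
  z-names : ∀ {g} → s₂ ◃ g → Below p g × ¬ Below b g
  z-names {g} s₂◃g = below-trans g (inside zPos p) (s₂-receives s₂◃g) , siblings g (λ ()) (s₂-receives s₂◃g)

  z-unused : ∀ {t g} → t ∈ s ∷ T′ → s₂ ◃ g → ¬ g ∈ₒ t
  z-unused (here refl) s₂◃g g∈s with s-objects g∈s
  ... | inj₁ g⋢p       = g⋢p (proj₁ (z-names s₂◃g))
  ... | inj₂ (g⊑b , _) = proj₂ (z-names s₂◃g) g⊑b
  z-unused (there m) s₂◃g g∈t with cont-objects m g∈t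
  ... | inj₁ g⋢p = g⋢p (proj₁ (z-names s₂◃g))
  ... | inj₂ g⊑b = proj₂ (z-names s₂◃g) g⊑b

  cont-inside-p : Suffix _≡_ p q
  cont-inside-p = Suffix.trans trans (inside bodyPos p) cont-inside

  -- Inputs have subjects bound inside p, unlike the subject c of s₁;
  -- the subjects y of s₂ and w of s lie outside the body, those of T′
  -- inside it.
  polarity′ : ∀ {r r′} → r ∈ Ts → r′ ∈ Ts → pol r ≡ In → pol r′ ≡ Out → subj r ≢ subj r′
  polarity′ r∈ (here refl) r-in _ r≡c =
    proj₂ away (subst (Below p) r≡c (input-subject (All.lookup local″ r∈) r-in))
  polarity′ (here refl) _ () _
  polarity′ (there _) (there (here refl)) _ ()
  polarity′ (there (here refl)) (there (there (here refl))) _ _ y≡w =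
    not-below-shorter [] yPos (subst (Below (yPos ++ p)) (trans y≡w on-w) (inside [] (yPos ++ p)))
  polarity′ (there (here refl)) (there (there (there m))) _ _ y≡t =
    not-below-shorter yPos bodyPos (subst (Below b) (sym y≡t) (cont-subject m))
  polarity′ (there (there (here refl))) (there (there (here refl))) s-in s-out _ =
    In≢Out (trans (sym s-in) s-out)
  polarity′ (there (there (here refl))) (there (there (there m))) _ _ w≡t =
    w⋢b (subst (Below b) (sym w≡t) (cont-subject m))
  polarity′ (there (there (there m))) (there (there (here refl))) _ _ t≡w =
    w⋢b (subst (Below b) t≡w (cont-subject m))
  polarity′ (there (there (there m))) (there (there (there m′))) r-in r′-out = polarity I m m′ r-in r′-out

  -- s₁ reaches everything; z (received by s₂) is mentioned only by s₂;
  -- body names (received by s or T′) are not mentioned by s₁, s₂; names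
  -- received by T′ are not mentioned by s; s reaches T′ through c′.
  closure′ : ∀ {t₁ t₂ g} → t₁ ∈ Ts → t₂ ∈ Ts → t₁ ◃ g → g ∈ₒ t₂ → t₁ ≡ t₂ ⊎ Reach Ts t₁ t₂
  closure′ (here refl) (here refl) _ _ = inj₁ refl
  closure′ (here refl) (there m)   _ _ = inj₂ (s₁-reaches m)
  closure′ (there (here refl)) (here refl) s₂◃g g∈s₁ =
    ⊥-elim (proj₂ (s₁-objects g∈s₁) (s₂-receives s₂◃g))
  closure′ (there (here refl)) (there (here refl)) _ _ = inj₁ refl
  closure′ (there (here refl)) (there (there m)) s₂◃g g∈t = ⊥-elim (z-unused m s₂◃g g∈t)
  closure′ (there (there (here refl))) (here refl) s◃g g∈s₁ =
    ⊥-elim (proj₁ (s₁-objects g∈s₁) (s-receives _ s◃g))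
  closure′ (there (there (here refl))) (there (here refl)) s◃g g∈s₂ =
    ⊥-elim (s₂-objects g∈s₂ (s-receives _ s◃g))
  closure′ (there (there (here refl))) (there (there (here refl))) _ _ = inj₁ refl
  closure′ (there (there (here refl))) (there (there (there m))) _ _ =
    inj₂ (reach-mono cont (channel I receives-c′ m))
  closure′ (there (there (there m))) (here refl) t◃g g∈s₁ =
    ⊥-elim (proj₁ (s₁-objects g∈s₁) (cont-receives m _ t◃g))
  closure′ (there (there (there m))) (there (here refl)) t◃g g∈s₂ =
    ⊥-elim (s₂-objects g∈s₂ (cont-receives m _ t◃g))
  closure′ {g = g} (there (there (there m))) (there (there (here refl))) t◃g g∈s
    with s-objects g∈s
  ... | inj₁ g⋢p       = ⊥-elim (g⋢p (below-trans g cont-inside-p (receives-below (local′ m) g t◃g)))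
  ... | inj₂ (_ , g⋢q) = ⊥-elim (g⋢q (receives-below (local′ m) g t◃g))
  closure′ (there (there (there m))) (there (there (there m′))) t◃g g∈t =
    map₂ (reach-mono cont) (closure I m m′ t◃g g∈t)

  channel′ : ∀ {t₀ t} → t₀ ◃ c → t ∈ Ts → Reach Ts t₀ t
  channel′ t₀◃c (here refl) = direct t₀◃c
  channel′ t₀◃c (there m)   = via (here refl) t₀◃c (s₁-reaches m)

  result : Inv σ c p Ts
  result = record
    { local = local″ ; apart = apart′ ; polarity = polarity′ ; closure = closure′ ; channel = channel′ }

in-body : ∀ {σ c p} x →
          Body σ c p (upd σ x (bd (bodyPos ++ p))) (bd (v′Pos ++ p)) (inContPos ++ p) (inSolo c p)
in-body {σ} {c} {p} x = record
  { on-w          = refl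
  ; proper-s      = record { receives-once = once ; send-receive = λ _ _ _ _ → refl }
  ; cont-inside   = inside (Rt ∷ N ∷ N ∷ []) (bodyPos ++ p)
  ; receives-body = received
  ; objects-s     = λ { g (zero , refl) → inj₂ (zero , refl , refl)
                      ; g (suc zero , refl) → inj₁ (inj₁ refl)
                      ; g (suc (suc zero) , refl) → inj₂ (suc (suc zero) , refl , refl) }
  ; receives-c′   = suc (suc zero) , refl , refl
  ; context       = bound }
  where
  x≢v′ : bd (bodyPos ++ p) ≢ bd (v′Pos ++ p)
  x≢v′ x≡v′ =
    not-below-shorter bodyPos v′Pos (subst (Below (v′Pos ++ p)) (sym x≡v′) (inside [] (v′Pos ++ p)))
  once : ∀ i j g → Occurs R (inSolo c p) i g → Occurs R (inSolo c p) j g → i ≡ j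
  once zero             zero             _ _ _ = refl
  once (suc (suc zero)) (suc (suc zero)) _ _ _ = refl
  once zero             (suc (suc zero)) _ (refl , _) (v′≡x , _) = ⊥-elim (x≢v′ (sym v′≡x))
  once (suc (suc zero)) zero             _ (refl , _) (x≡v′ , _) = ⊥-elim (x≢v′ x≡v′)
  once (suc zero) _ _ (_ , ()) _
  once _ (suc zero) _ _ (_ , ())
  received : ∀ g → inSolo c p ◃ g → Below (bodyPos ++ p) g × ¬ Below (inContPos ++ p) g
  received g (zero , refl , _)           = inside [] (bodyPos ++ p) , not-below-shorter bodyPos inContPos
  received g (suc (suc zero) , refl , _) = inside (N ∷ []) (bodyPos ++ p) , not-below-shorter v′Pos inContPos
  received g (suc zero , _ , ())
  bound : ∀ n → upd σ x (bd (bodyPos ++ p)) n ≡ σ n ⊎ inSolo c p ◃ upd σ x (bd (bodyPos ++ p)) n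
  bound n with n ≡ᵇ x
  ... | true  = inj₂ (zero , refl , refl)
  ... | false = inj₁ refl

out-body : ∀ {σ c p} x → Outside σ c p →
           Body σ c p σ (bd (bodyPos ++ p)) (outContPos ++ p) (outSolo c (σ x) p)
out-body {σ} {c} {p} x away = record
  { on-w          = refl
  ; proper-s      = record { receives-once = once ; send-receive = send-receive′ }
  ; cont-inside   = inside (Rt ∷ N ∷ []) (bodyPos ++ p)
  ; receives-body = λ { g (suc zero , refl , _) →
                            inside [] (bodyPos ++ p) , not-below-shorter bodyPos outContPos
                      ; g (zero , _ , ())
                      ; g (suc (suc zero) , _ , ()) }
  ; objects-s     = λ { g (zero , refl) → inj₁ (inj₂ (x , refl))
                      ; g (suc zero , refl) → inj₂ (suc zero , refl , refl)
                      ; g (suc (suc zero) , refl) → inj₁ (inj₁ refl) }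
  ; receives-c′   = suc zero , refl , refl
  ; context       = λ _ → inj₁ refl }
  where
  once : ∀ i j g → Occurs R (outSolo c (σ x) p) i g → Occurs R (outSolo c (σ x) p) j g → i ≡ j
  once (suc zero) (suc zero) _ _ _ = refl
  once zero _ _ (_ , ()) _
  once (suc (suc zero)) _ _ (_ , ()) _
  once (suc zero) zero _ _ (_ , ())
  once (suc zero) (suc (suc zero)) _ _ (_ , ())
  -- the sent names x and v are context names, the received v′ is not
  send-receive′ : ∀ i g → Occurs S (outSolo c (σ x) p) i g → outSolo c (σ x) p ◃ g → Out ≡ In
  send-receive′ zero g (refl , _) (suc zero , v′≡σx , _) =
    ⊥-elim (proj₁ away x (subst (Below p) v′≡σx (inside bodyPos p)))
  send-receive′ (suc (suc zero)) g (refl , _) (suc zero , v′≡c , _) =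
    ⊥-elim (proj₂ away (subst (Below p) v′≡c (inside bodyPos p)))
  send-receive′ _ g _ (zero , _ , ())
  send-receive′ _ g _ (suc (suc zero) , _ , ())
  send-receive′ (suc zero) g (_ , ()) _

outside-inner : ∀ {σ c p} e → Outside σ c p → Outside σ c (e ++ p)
outside-inner {σ} {c} {p} e (σ-out , c-out) =
  (λ n σn⊑ → σ-out n (below-trans (σ n) (inside e p) σn⊑)) , (λ c⊑ → c-out (below-trans c (inside e p) c⊑))

outside-bind : ∀ {σ p} x g → (∀ n → ¬ Below p (σ n)) → ¬ Below p g → ∀ n → ¬ Below p (upd σ x g n)
outside-bind x g σ-out g⋢p n with n ≡ᵇ x
... | true  = g⋢p
... | false = σ-out n

inv : ∀ P {σ c p} → Outside σ c p → Inv σ c p (solosTr σ c p P)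
inv nil away = inv-nil
inv (inp u x P) away =
  Prefix.result away u (in-body x)
    (inv P ( outside-bind x _ (proj₁ (outside-inner inContPos away)) (not-below-shorter bodyPos inContPos)
           , not-below-shorter v′Pos inContPos))
inv (out u x P) away =
  Prefix.result away u (out-body x away)
    (inv P (proj₁ (outside-inner outContPos away) , not-below-shorter bodyPos outContPos))
inv (par P Q) away = inv-par away (inv P (outside-inner (L ∷ []) away)) (inv Q (outside-inner (Rt ∷ []) away))
inv (nu x P) away =
  inv-nu (inv P ( outside-bind x _ (proj₁ (outside-inner (N ∷ []) away)) (not-below-shorter [] (N ∷ []))
                , proj₂ (outside-inner (N ∷ []) away)))

-- The acyclicity conditions for a list of resolved solos, stated on the
-- solos themselves rather than on their indices.
record AcyclicSolos (Ss : List RSolo) : Set where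
  field
    all-proper : All Proper Ss
    all-apart  : AllPairs Apart Ss
    roots      : ∀ {r r′ t} → r ∈ Ss → r′ ∈ Ss → pol r ≡ In → pol r′ ≡ Out → subj r ≡ subj r′ →
                 t ∈ Ss → ¬ t ◃ subj r
    linked     : ∀ {s t g} → s ∈ Ss → t ∈ Ss → s ◃ g → g ∈ₒ t → s ≡ t ⊎ Reach Ss s t
    no-free    : ∀ {t n} → t ∈ Ss → ¬ t ◃ fr n

receivers-unique : ∀ Ss → AllPairs Apart Ss → All Proper Ss → Relations.AC1 Ss
receivers-unique (t ∷ Ss) (_ ∷ _) (t-proper ∷ _) g zero i zero j o₁ o₂ =
  refl , Proper.receives-once t-proper i j g o₁ o₂
receivers-unique (t ∷ Ss) (t-apart ∷ _) _ g zero i (suc k) j o₁ o₂ =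
  ⊥-elim (All.lookup t-apart (∈-lookup k) g (i , o₁) (j , o₂))
receivers-unique (t ∷ Ss) (t-apart ∷ _) _ g (suc k) i zero j o₁ o₂ =
  ⊥-elim (All.lookup t-apart (∈-lookup k) g (j , o₂) (i , o₁))
receivers-unique (t ∷ Ss) (_ ∷ ap) (_ ∷ pr) g (suc k) i (suc l) j o₁ o₂
  with receivers-unique Ss ap pr g k i l j o₁ o₂
... | refl , refl = refl , refl

module Transfer {Ss : List RSolo} (A : AcyclicSolos Ss) where
  open Relations Ss
  open AcyclicSolos A

  member : ∀ s → sol s ∈ Ss
  member = ∈-lookup

  ac1 : AC1
  ac1 = receivers-unique Ss all-apart all-proper

  -- an input and an output on the same subject are roots, as nobody
  -- receives their subject
  clash-roots : ∀ {s t} → pol (sol s) ≡ In → pol (sol t) ≡ Out → subj (sol s) ≡ subj (sol t) →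
                IsRoot s × IsRoot t
  clash-roots {s} {t} s-in t-out same = s-root , subst (λ g → ¬ ∃ λ t′ → sol t′ ◃ g) same s-root
    where
    s-root : IsRoot s
    s-root (t′ , t′◃s) = roots (member s) (member t) s-in t-out same (member t′) t′◃s

  ac2 : AC2
  ac2 s t (same , differ) with pol (sol s) in s-pol | pol (sol t) in t-pol
  ... | In  | In  = ⊥-elim (differ refl)
  ... | Out | Out = ⊥-elim (differ refl)
  ... | In  | Out = clash-roots s-pol t-pol same
  ... | Out | In  = swap (clash-roots t-pol s-pol (sym same))

  reach-star : ∀ {s t r} → sol s ≡ r → Reach Ss r (sol t) → s ◁⋆ t
  reach-star refl (direct o)     = o ◅ ε
  reach-star refl (via m o rest) =
    subst (λ r → _ ◃ subj r) (lookup-index m) o ◅ reach-star (sym (lookup-index m)) rest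

  -- equal solos are equal occurrences, as they receive g at the same place
  ac3 : AC3
  ac3 s t g (i , o) g∈t with linked (member s) (member t) (i , o) g∈t
  ... | inj₁ s≡t = subst (s ◁⋆_) (proj₁ (ac1 g s i t i o (subst (λ r → Occurs R r i g) s≡t o))) ε
  ... | inj₂ s⇝t = reach-star refl s⇝t

  ac4 : AC4
  ac4 s i g so o = Proper.send-receive (All.lookup all-proper (member s)) i g so o

  ac5 : AC5
  ac5 s n = no-free (member s)

acyclic : ∀ {Γ P} → Γ ⊢ P → AcyclicSolos (solosOf Γ P) → Acyclic Γ P
acyclic ⊢P A = record
  { typed = ⊢P ; ac1 = Transfer.ac1 A ; ac2 = Transfer.ac2 A ; ac3 = Transfer.ac3 A
  ; ac4 = Transfer.ac4 A ; ac5 = Transfer.ac5 A }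

-- Closing the translation, ⟦P⟧ = (ν v)(⟦P⟧_v | C(v)): v is bound at the
-- root, ⟦P⟧_v sits at L ∷ N ∷ [], and C(v), whose z is bound at
-- Rt ∷ N ∷ [], contributes the solo v(z z v).
rootPos : List Dir
rootPos = L ∷ N ∷ []

z₀ : GN
z₀ = bd (Rt ∷ N ∷ [])

closeSolo : RSolo
closeSolo = mkSolo In (bd []) V z₀ z₀ (bd [])

closedSolos : Pi → List RSolo
closedSolos P = solosTr fr (bd []) rootPos P ++ closeSolo ∷ []

z₀⋢root : ¬ Below rootPos z₀
z₀⋢root z₀⊑ = siblings z₀ (λ ()) z₀⊑ (inside [] (Rt ∷ N ∷ []))

close-receives : ∀ {g} → closeSolo ◃ g → g ≡ z₀
close-receives (zero , refl , _) = refl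
close-receives (suc zero , _ , ())
close-receives (suc (suc zero) , _ , ())

close-objects : ∀ {g} → g ∈ₒ closeSolo → ¬ Below rootPos g
close-objects (zero , refl)           = z₀⋢root
close-objects (suc zero , refl)       = z₀⋢root
close-objects (suc (suc zero) , refl) = not-below-shorter [] rootPos

close-proper : Proper closeSolo
close-proper = record { receives-once = once ; send-receive = λ _ _ _ _ → refl }
  where
  once : ∀ i j g → Occurs R closeSolo i g → Occurs R closeSolo j g → i ≡ j
  once zero zero _ _ _ = refl
  once (suc zero) _ _ (_ , ()) _
  once (suc (suc zero)) _ _ (_ , ()) _
  once zero (suc zero) _ _ (_ , ())
  once zero (suc (suc zero)) _ _ (_ , ())

-- The closing solo receives z₀, which no other solo mentions, and has
-- the channel v as subject, which no solo receives: it is the only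
-- input on v, and v is a root.
closed-acyclic : ∀ P → AcyclicSolos (closedSolos P)
closed-acyclic P = record
  { all-proper = All.++⁺ (All.map Local.proper (Inv.local I)) (close-proper ∷ [])
  ; all-apart  = AllPairs.++⁺ (Inv.apart I) ([] ∷ [])
                   (All.tabulate λ {t} m → apart-by {t} {closeSolo} (λ g → ¬ Below rootPos g)
                                         (λ g t◃g g⋢ → g⋢ (Local.receives-below (local-at m) g t◃g))
                                         (λ g c◃g → close-objects (received-object {closeSolo} c◃g))
                                     ∷ [])
  ; roots      = roots
  ; linked     = linked
  ; no-free    = no-free }
  where
  Tr Ss : List RSolo
  Tr = solosTr fr (bd []) rootPos P
  Ss = closedSolos P
  I : Inv fr (bd []) rootPos Tr
  I = inv P ((λ n ()) , not-below-shorter [] rootPos)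
  local-at : ∀ {t} → t ∈ Tr → Local fr (bd []) rootPos t
  local-at = All.lookup (Inv.local I)

  split : ∀ {t} → t ∈ Ss → t ∈ Tr ⊎ t ≡ closeSolo
  split m with ∈-++⁻ Tr m
  ... | inj₁ m′         = inj₁ m′
  ... | inj₂ (here t≡c) = inj₂ t≡c

  nobody-receives-root : ∀ {t} → t ∈ Ss → ¬ t ◃ bd []
  nobody-receives-root m t◃ with split m
  ... | inj₁ m′   = not-below-shorter [] rootPos (Local.receives-below (local-at m′) (bd []) t◃)
  ... | inj₂ refl with close-receives t◃
  ...   | ()

  roots : ∀ {r r′ t} → r ∈ Ss → r′ ∈ Ss → pol r ≡ In → pol r′ ≡ Out → subj r ≡ subj r′ →
          t ∈ Ss → ¬ t ◃ subj r
  roots r∈ r′∈ r-in r′-out same t∈ with split r∈ | split r′∈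
  ... | inj₁ a    | inj₁ b    = ⊥-elim (Inv.polarity I a b r-in r′-out same)
  ... | _         | inj₂ refl = ⊥-elim (In≢Out r′-out)
  ... | inj₂ refl | inj₁ _    = nobody-receives-root t∈

  linked : ∀ {s t g} → s ∈ Ss → t ∈ Ss → s ◃ g → g ∈ₒ t → s ≡ t ⊎ Reach Ss s t
  linked s∈ t∈ s◃g g∈t with split s∈ | split t∈
  ... | inj₁ a | inj₁ b = map₂ (reach-mono ∈-++⁺ˡ) (Inv.closure I a b s◃g g∈t)
  ... | inj₂ refl | inj₂ refl = inj₁ refl
  linked {g = g} s∈ t∈ s◃g g∈t | inj₁ a | inj₂ refl =
    ⊥-elim (close-objects g∈t (Local.receives-below (local-at a) g s◃g))
  linked {g = g} s∈ t∈ s◃g g∈t | inj₂ refl | inj₁ b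
    with close-receives s◃g | Local.objects (local-at b) g g∈t
  ... | refl | inj₁ (inj₁ ())
  ... | refl | inj₁ (inj₂ (_ , ()))
  ... | refl | inj₂ z₀⊑ = ⊥-elim (z₀⋢root z₀⊑)

  no-free : ∀ {t n} → t ∈ Ss → ¬ t ◃ fr n
  no-free {n = n} m t◃ with split m
  ... | inj₁ m′ = Local.receives-below (local-at m′) (fr n) t◃
  ... | inj₂ refl with close-receives t◃
  ...   | ()

solos-⟦⟧ : ∀ P → solosOf (freeW P) ⟦ P ⟧ ≡ closedSolos P
solos-⟦⟧ P =
  cong₂ _++_ (trans (flatten-tr P {upd fr v (bd [])} {fr} {upd (freeW P) v (just V)} {v} {2 + v} {rootPos}
                                (n<1+n _) (below+ 1 (n<1+n v)) (upd-≡ (freeW P) v _)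
                                (agree-fresh _ (n<1+n _) (λ _ _ → refl)))
                    (cong (λ c → solosTr fr c rootPos P) (upd-≡ fr v (bd []))))
             (flatten-C {upd fr v (bd [])} {upd (freeW P) v (just V)}
                        (<⇒≢ (n<1+n v)) (upd-≡ fr v _) (upd-≡ (freeW P) v _))
  where
  v : ℕ
  v = suc (maxName P)

freeW-W : ∀ P → FreeW P (freeW P)
freeW-W P n h with isFree P n
... | true  = refl
... | false = ⊥-elim h

⟦⟧-typed : ∀ P → freeW P ⊢ ⟦ P ⟧
⟦⟧-typed P =
  t-nu (t-par (tr-typed P (n<1+n _) (below+ 1 (n<1+n v)) (upd-≡ (freeW P) v _)
                        (freeW-agree P (agree-fresh _ (n<1+n _) (λ _ _ → refl)) (freeW-W P)))
              (C-typed {upd (freeW P) v (just V)} (<⇒≢ (n<1+n v)) (upd-≡ (freeW P) v _)))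
  where
  v : ℕ
  v = suc (maxName P)

theorem5p11 : (P : Pi) → Acyclic (freeW P) ⟦ P ⟧
theorem5p11 P = acyclic (⟦⟧-typed P) (subst AcyclicSolos (sym (solos-⟦⟧ P)) (closed-acyclic P))
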